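{- For each fixed integer $n\ge1$, as $k\to\infty$, $$P'(1,n,k)\sim\frac{k^n}{n},$$ where $P'(1,n,k)$ is the number of 1-ball prime passing patterns of period $n$ with $k$ hands.
   Context: A 1-ball passing state with $k$ hands is a $k\times\infty$ $\{0,1\}$-matrix $A=(a_{i,j})$ with exactly one entry equal to $1$ ($a_{i,j}=1$ means the ball lands at hand $i$ in $j$ beats). There is a transition $A\to B$ iff $a_{i,j+1}\le b_{i,j}$ for all $i$ and all $j\ge1$. A prime passing pattern of period $n$ is a directed cycle of length $n$ in this graph, counted up to cyclic rotation. -}

module Defs where

open import Data.Nat using (ℕ; zero; suc; _+_; _≤_; _<_)
open import Data.Fin using (Fin)
import Data.Fin as Fin
import Data.Nat as Nat
open import Data.Bool using (if_then_else_; _∧_)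
open import Data.Product using (Σ; _×_; _,_; ∃)
open import Relation.Nullary.Decidable using (⌊_⌋)
open import Relation.Binary.PropositionalEquality using (_≡_)

-- A 1-ball passing state with k hands: a k×∞ {0,1}-matrix with exactly one
-- entry equal to 1.  It is determined by the position (i , j) of that 1,
-- with i : Fin k a hand and j ≥ 1 a number of beats.  We store j as suc j'.
State : ℕ → Set
State k = Fin k × ℕ

entry : ∀ {k} → State k → Fin k → ℕ → ℕ
entry (i0 , j0) i j = if ⌊ i Fin.≟ i0 ⌋ ∧ ⌊ j Nat.≟ suc j0 ⌋ then 1 else 0

_⟶_ : ∀ {k} → State k → State k → Set
A ⟶ B = ∀ i j → 1 ≤ j → entry A i (suc j) ≤ entry B i j

record Cycle (n k : ℕ) : Set where
  field
    vert     : ℕ → State k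
    periodic : ∀ t → vert (t + n) ≡ vert t
    step     : ∀ t → vert t ⟶ vert (suc t)
    distinct : ∀ s t → s < n → t < n → vert s ≡ vert t → s ≡ t
open Cycle public

_≈rot_ : ∀ {n k} → Cycle n k → Cycle n k → Set
c ≈rot d = ∃ λ r → ∀ t → vert d t ≡ vert c (t + r)

-- "There are exactly m prime passing patterns of period n with k hands":
-- an enumeration Fin m → Cycle n k hitting every rotation class exactly once.
PrimeCount : ℕ → ℕ → ℕ → Set
PrimeCount n k m =
  Σ (Fin m → Cycle n k) λ f →
    (∀ (c : Cycle n k) → ∃ λ x → f x ≈rot c) ×
    (∀ x y → f x ≈rot f y → x ≡ y)

{-# OPTIONS --safe #-}
module Submission where

-- A ball in the air only falls, so a state with height h > 0 has a unique successor and keeps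
-- its hand; only at height 0 is the ball thrown, anywhere.  The vertices of a cycle are distinct,
-- so its n rotations are distinct closed walks and n · P(k) is the number of closed walks of
-- length n (compared on one period).  A closed walk in which no two beats share a hand has all
-- heights 0, so these walks are the injective maps Fin n → Fin k: all but O(k^(n−1)) of the k^n
-- hand assignments.  A walk with a repeated hand is determined by its heights, the two positions
-- and the other n − 1 hands, so there are only O(k^(n−1)) of them.  Hence
-- |n · P(k) − k^n| = O(k^(n−1)).

open import Defs
open import Data.Fin as Fin
  using (Fin; toℕ; fromℕ<; combine; remQuot; splitAt; _↑ˡ_; _↑ʳ_; funToFin; finToFun; punchIn; punchOut)
open import Data.Fin.Properties
  using ( toℕ-fromℕ<; toℕ-injective; toℕ<n; finToFun-funToFin; funToFin-finToFin; combine-injective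
        ; remQuot-combine; combine-remQuot; splitAt-↑ˡ; splitAt-↑ʳ; ↑ˡ-injective; ↑ʳ-injective
        ; injective⇒≤; punchIn-punchOut; any?; all?)
open import Data.List using (List; []; _∷_; lookup; length; allFin; concatMap; deduplicate)
import Data.List.Relation.Unary.All as All
open import Data.List.Relation.Unary.Any as Any using (Any; here)
open import Data.List.Relation.Unary.Any.Properties using (concatMap⁺)
open import Data.List.Relation.Unary.Enumerates.Setoid using (IsEnumeration)
open import Data.List.Relation.Unary.Enumerates.Setoid.Properties using (deduplicate⁺; lookup-surjective)
import Data.List.Relation.Unary.Unique.Setoid as UniqueSetoid
open import Data.List.Relation.Unary.Unique.DecSetoid.Properties using (deduplicate-!)
open import Data.List.Membership.Propositional.Properties using (∈-lookup; ∈-allFin)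
open import Data.Nat as ℕ
  using ( ℕ; zero; suc; _+_; _*_; _∸_; _^_; _≤_; _<_; _≤?_; z≤n; s≤s; NonZero; >-nonZero⁻¹
        ; ∣_-_∣; _%_; _/_)
open import Data.Nat.Properties
open import Algebra.Properties.CommutativeSemigroup +-commutativeSemigroup using (x∙yz≈xz∙y; xy∙z≈xz∙y)
open import Data.Nat.DivMod using (_mod_; m%n<n; m≡m%n+[m/n]*n; [m+kn]%n≡m%n; [m+n]%n≡m%n; m<n⇒m%n≡m)
open import Data.Nat.Divisibility using (divides; ∣1⇒≡1)
open import Data.Product using (Σ; _×_; _,_; proj₁; proj₂; ∃; ∃₂; uncurry)
open import Data.Product.Properties using (≡-dec)
open import Data.Sum using (_⊎_; inj₁; inj₂)
open import Data.Unit using (⊤; tt)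
open import Function.Base using (_∘_)
open import Level using (0ℓ)
open import Relation.Binary.Bundles using (Setoid; DecSetoid)
open import Relation.Binary.Definitions
  using (DecidableEquality; Decidable; Reflexive; Symmetric; Transitive)
open import Relation.Binary.PropositionalEquality
open import Relation.Nullary using (¬_; Dec; yes; no; contradiction; ¬?; _×-dec_; _→-dec_)
open import Relation.Nullary.Decidable using (map′)

∣m-n∣≤o : ∀ {m n o} → m ≤ n + o → n ≤ m + o → ∣ m - n ∣ ≤ o
∣m-n∣≤o {m} {n} {o} m≤n+o n≤m+o with ≤-total m n
... | inj₁ m≤n = subst (_≤ o) (sym (m≤n⇒∣m-n∣≡n∸m m≤n)) (m≤n+o⇒m∸n≤o n m n≤m+o)
... | inj₂ n≤m = subst (_≤ o) (sym (m≤n⇒∣n-m∣≡n∸m n≤m)) (m≤n+o⇒m∸n≤o m n m≤n+o)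

relative-error : ∀ {d c k} e n′ → d ≤ c * k ^ n′ → suc e * c ≤ k → suc e * d ≤ k ^ suc n′
relative-error {d} {c} {k} e n′ d≤ck^n′ [1+e]c≤k = begin
  suc e * d              ≤⟨ *-monoʳ-≤ (suc e) d≤ck^n′ ⟩
  suc e * (c * k ^ n′)   ≡⟨ *-assoc (suc e) c (k ^ n′) ⟨
  suc e * c * k ^ n′     ≤⟨ *-monoˡ-≤ (k ^ n′) [1+e]c≤k ⟩
  k * k ^ n′             ∎
  where open ≤-Reasoning

funToFin-injective : ∀ {m n} {f g : Fin m → Fin n} → funToFin f ≡ funToFin g → f ≗ g
funToFin-injective {f = f} {g} e i = begin
  f i                      ≡⟨ finToFun-funToFin f i ⟨
  finToFun (funToFin f) i  ≡⟨ cong (λ z → finToFun z i) e ⟩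
  finToFun (funToFin g) i  ≡⟨ finToFun-funToFin g i ⟩
  g i                      ∎
  where open ≡-Reasoning

funToFin-cong : ∀ {m n} {f g : Fin m → Fin n} → f ≗ g → funToFin f ≡ funToFin g
funToFin-cong {zero}  _   = refl
funToFin-cong {suc m} f≗g = cong₂ combine (f≗g Fin.zero) (funToFin-cong (f≗g ∘ Fin.suc))

finToFun-injective : ∀ {m n} {y z : Fin (m ^ n)} → finToFun y ≗ finToFun z → y ≡ z
finToFun-injective {m} {n} {y} {z} y≗z = begin
  y                              ≡⟨ funToFin-finToFin {n} {m} y ⟨
  funToFin (finToFun {m} {n} y)  ≡⟨ funToFin-cong {n} {m} y≗z ⟩
  funToFin (finToFun {m} {n} z)  ≡⟨ funToFin-finToFin {n} {m} z ⟩
  z                              ∎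
  where open ≡-Reasoning

remQuot-injective : ∀ {m n} {y z : Fin (m * n)} → remQuot {m} n y ≡ remQuot n z → y ≡ z
remQuot-injective {m} {n} {y} {z} e =
  trans (sym (combine-remQuot {m} n y)) (trans (cong (uncurry combine) e) (combine-remQuot {m} n z))

↑ˡ≢↑ʳ : ∀ {m n} (i : Fin m) (j : Fin n) → i ↑ˡ n ≢ m ↑ʳ j
↑ˡ≢↑ʳ {m} {n} i j e =
  contradiction (trans (sym (splitAt-↑ˡ m i n)) (trans (cong (splitAt m) e) (splitAt-↑ʳ m n j))) λ ()

module _ {a ℓ} (S : Setoid a ℓ) where
  open Setoid S using (_≈_) renaming (sym to ≈-sym)
  open UniqueSetoid S using (Unique; _∷_)

  Unique⇒lookup-injective : ∀ {xs} → Unique xs → ∀ i j → lookup xs i ≈ lookup xs j → i ≡ j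
  Unique⇒lookup-injective (_  ∷ _) Fin.zero    Fin.zero    _ = refl
  Unique⇒lookup-injective (x≉ ∷ _) Fin.zero    (Fin.suc j) e = contradiction e (All.lookup x≉ (∈-lookup j))
  Unique⇒lookup-injective (x≉ ∷ _) (Fin.suc i) Fin.zero    e =
    contradiction (≈-sym e) (All.lookup x≉ (∈-lookup i))
  Unique⇒lookup-injective (_  ∷ u) (Fin.suc i) (Fin.suc j) e =
    cong Fin.suc (Unique⇒lookup-injective u i j e)

module _ {A : Set} where

  Repeats : ∀ {n} → (Fin n → A) → Set
  Repeats v = ∃₂ λ s t → s ≢ t × v s ≡ v t

  repeats? : ∀ {n} → DecidableEquality A → (v : Fin n → A) → Dec (Repeats v)
  repeats? _≟_ v = any? λ s → any? λ t → ¬? (s Fin.≟ t) ×-dec (v s ≟ v t)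

  ¬repeats⇒injective : ∀ {n} {v : Fin n → A} → ¬ Repeats v → ∀ s t → v s ≡ v t → s ≡ t
  ¬repeats⇒injective ¬r s t vs≡vt with s Fin.≟ t
  ... | yes s≡t = s≡t
  ... | no  s≢t = contradiction (s , t , s≢t , vs≡vt) ¬r

  punchIn-agree : ∀ {n} {u v : Fin (suc n) → A} t → u ∘ punchIn t ≗ v ∘ punchIn t →
                  ∀ {j} → t ≢ j → u j ≡ v j
  punchIn-agree {u = u} {v} t u≗v t≢j = begin
    u _                            ≡⟨ cong u (punchIn-punchOut t≢j) ⟨
    u (punchIn t (punchOut t≢j))   ≡⟨ u≗v (punchOut t≢j) ⟩
    v (punchIn t (punchOut t≢j))   ≡⟨ cong v (punchIn-punchOut t≢j) ⟩
    v _                            ∎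
    where open ≡-Reasoning

-- The entry at t is recovered from the one at s.
repeatCode : ∀ {n k} (v : Fin (suc n) → Fin k) → Repeats v → Fin (suc n * (suc n * k ^ n))
repeatCode v (s , t , _ , _) = combine s (combine t (funToFin (v ∘ punchIn t)))

repeatCode-injective : ∀ {n k} {u v : Fin (suc n) → Fin k} (ru : Repeats u) (rv : Repeats v) →
                       repeatCode u ru ≡ repeatCode v rv → u ≗ v
repeatCode-injective {u = u} {v} (s , t , s≢t , us≡ut) (s′ , t′ , _ , vs≡vt) e
  with combine-injective s _ s′ _ e
... | refl , e′ with combine-injective t _ t′ _ e′
... | refl , e″ = agree
  where
  agree-off-t : ∀ {j} → t ≢ j → u j ≡ v j
  agree-off-t = punchIn-agree t (funToFin-injective e″)
  agree : u ≗ v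
  agree j with t Fin.≟ j
  ... | no  t≢j  = agree-off-t t≢j
  ... | yes refl = trans (sym us≡ut) (trans (agree-off-t (s≢t ∘ sym)) vs≡vt)

module _ {n : ℕ} .{{_ : NonZero n}} where

  toℕ-mod : ∀ t → toℕ (t mod n) ≡ t % n
  toℕ-mod t = toℕ-fromℕ< (m%n<n t n)

  toℕ-mod-< : ∀ {t} → t < n → toℕ (t mod n) ≡ t
  toℕ-mod-< t<n = trans (toℕ-mod _) (m<n⇒m%n≡m t<n)

  mod-toℕ : ∀ (i : Fin n) → toℕ i mod n ≡ i
  mod-toℕ i = toℕ-injective (toℕ-mod-< (toℕ<n i))

  next : Fin n → Fin n
  next i = suc (toℕ i) mod n

  suc-mod : ∀ t → suc t mod n ≡ next (t mod n)
  suc-mod t = toℕ-injective (begin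
    toℕ (suc t mod n)               ≡⟨ toℕ-mod (suc t) ⟩
    suc t % n                       ≡⟨ cong (λ s → suc s % n) (m≡m%n+[m/n]*n t n) ⟩
    (suc (t % n) + t / n * n) % n   ≡⟨ [m+kn]%n≡m%n (suc (t % n)) (t / n) n ⟩
    suc (t % n) % n                 ≡⟨ cong (λ s → suc s % n) (toℕ-mod t) ⟨
    suc (toℕ (t mod n)) % n         ≡⟨ toℕ-mod (suc (toℕ (t mod n))) ⟨
    toℕ (next (t mod n))            ∎)
    where open ≡-Reasoning

  -- next i = i would give i + q * n = 1 + i, so n divides 1.
  next≢ : 1 < n → ∀ i → next i ≢ i
  next≢ 1<n i next≡i = <⇒≢ 1<n (sym (∣1⇒≡1 (divides q (sym q*n≡1))))
    where
    open ≡-Reasoning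
    q = suc (toℕ i) / n
    r≡i : suc (toℕ i) % n ≡ toℕ i
    r≡i = trans (sym (toℕ-mod (suc (toℕ i)))) (cong toℕ next≡i)
    q*n≡1 : q * n ≡ 1
    q*n≡1 = +-cancelˡ-≡ (toℕ i) _ _ (begin
      toℕ i + q * n             ≡⟨ cong (_+ q * n) r≡i ⟨
      suc (toℕ i) % n + q * n   ≡⟨ m≡m%n+[m/n]*n (suc (toℕ i)) n ⟨
      suc (toℕ i)               ≡⟨ +-comm 1 (toℕ i) ⟩
      toℕ i + 1                 ∎)

Periodic : {X : Set} → ℕ → (ℕ → X) → Set
Periodic n w = ∀ t → w (t + n) ≡ w t

mod-periodic : ∀ {n} .{{_ : NonZero n}} → Periodic n (_mod n)
mod-periodic {n} t = toℕ-injective (trans (toℕ-mod (t + n)) (trans ([m+n]%n≡m%n t n) (sym (toℕ-mod t))))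

module _ {X : Set} {n : ℕ} {w : ℕ → X} (per : Periodic n w) where

  periodic-+* : ∀ t q → w (t + q * n) ≡ w t
  periodic-+* t zero    = cong w (+-identityʳ t)
  periodic-+* t (suc q) = begin
    w (t + (n + q * n))  ≡⟨ cong w (x∙yz≈xz∙y t n (q * n)) ⟩
    w (t + q * n + n)    ≡⟨ per (t + q * n) ⟩
    w (t + q * n)        ≡⟨ periodic-+* t q ⟩
    w t                  ∎
    where open ≡-Reasoning

  shift-periodic : ∀ r → Periodic n (λ t → w (t + r))
  shift-periodic r t = trans (cong w (xy∙z≈xz∙y t n r)) (per (t + r))

  module _ .{{_ : NonZero n}} where

    periodic-mod : ∀ t → w t ≡ w (toℕ (t mod n))
    periodic-mod t = begin
      w t                      ≡⟨ cong w (m≡m%n+[m/n]*n t n) ⟩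
      w (t % n + t / n * n)    ≡⟨ periodic-+* (t % n) (t / n) ⟩
      w (t % n)                ≡⟨ cong w (toℕ-mod t) ⟨
      w (toℕ (t mod n))        ∎
      where open ≡-Reasoning

    shift-mod : ∀ t r → w (t + r) ≡ w (t + toℕ (r mod n))
    shift-mod t r = begin
      w (t + r)                    ≡⟨ cong (λ s → w (t + s)) (m≡m%n+[m/n]*n r n) ⟩
      w (t + (r % n + r / n * n))  ≡⟨ cong w (+-assoc t (r % n) _) ⟨
      w (t + r % n + r / n * n)    ≡⟨ periodic-+* (t + r % n) (r / n) ⟩
      w (t + r % n)                ≡⟨ cong (λ s → w (t + s)) (toℕ-mod r) ⟨
      w (t + toℕ (r mod n))        ∎
      where open ≡-Reasoning

periodic-agree : ∀ {X : Set} {n} .{{_ : NonZero n}} {u v : ℕ → X} → Periodic n u → Periodic n v →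
                 (∀ (i : Fin n) → u (toℕ i) ≡ v (toℕ i)) → ∀ t → u t ≡ v t
periodic-agree pu pv u≗v t = trans (periodic-mod pu t) (trans (u≗v (t mod _)) (sym (periodic-mod pv t)))

-- In the encoding of Defs, (i , h) is the ball landing at hand i in h + 1 beats.
_↝_ : ∀ {k} → State k → State k → Set
(i , zero)  ↝ B = ⊤
(i , suc h) ↝ B = B ≡ (i , h)

module _ {k : ℕ} where

  entry-cases : ∀ (A : State k) i j → entry A i j ≡ 0 ⊎ (i , j) ≡ (proj₁ A , suc (proj₂ A))
  entry-cases (i₀ , j₀) i j with i Fin.≟ i₀ | j ℕ.≟ suc j₀
  ... | yes refl | yes refl = inj₂ refl
  ... | yes _    | no _     = inj₁ refl
  ... | no _     | _        = inj₁ refl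

  entry-self : ∀ (A : State k) → entry A (proj₁ A) (suc (proj₂ A)) ≡ 1
  entry-self (i₀ , j₀) with i₀ Fin.≟ i₀ | suc j₀ ℕ.≟ suc j₀
  ... | yes _ | yes _ = refl
  ... | yes _ | no ¬p = contradiction refl ¬p
  ... | no ¬p | _     = contradiction refl ¬p

  ↝⇒⟶ : ∀ {A B : State k} → A ↝ B → A ⟶ B
  ↝⇒⟶ {A} {B} A↝B i j 1≤j with entry-cases A i (suc j)
  ... | inj₁ a≡0 rewrite a≡0 = z≤n
  ↝⇒⟶ {i₀ , zero}  {B} _    i j 1≤j | inj₂ refl = contradiction 1≤j λ ()
  ↝⇒⟶ {i₀ , suc h} {B} refl i j _   | inj₂ refl
    rewrite entry-self (i₀ , suc h) | entry-self B = ≤-refl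

  ⟶⇒↝ : ∀ {A B : State k} → A ⟶ B → A ↝ B
  ⟶⇒↝ {i₀ , zero}      _   = tt
  ⟶⇒↝ {i₀ , suc h} {B} A⟶B with entry-cases B i₀ (suc h) | A⟶B i₀ (suc h) (s≤s z≤n)
  ... | inj₁ b≡0  | 1≤b rewrite entry-self (i₀ , suc h) | b≡0 = contradiction 1≤b λ ()
  ... | inj₂ refl | _   = refl

  ↝-hand : ∀ {A B : State k} → A ↝ B → proj₂ A ≢ 0 → proj₁ B ≡ proj₁ A
  ↝-hand {i , zero}  _    h≢0 = contradiction refl h≢0
  ↝-hand {i , suc h} refl _   = refl

  _≟ₛ_ : DecidableEquality (State k)
  _≟ₛ_ = ≡-dec Fin._≟_ ℕ._≟_

  _↝?_ : ∀ (A B : State k) → Dec (A ↝ B)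
  (i , zero)  ↝? B = yes tt
  (i , suc h) ↝? B = B ≟ₛ (i , h)

record ClosedWalk (n k : ℕ) : Set where
  field
    pos          : ℕ → State k
    pos-periodic : Periodic n pos
    pos-step     : ∀ t → pos t ↝ pos (suc t)
open ClosedWalk public

module _ {n k : ℕ} where

  hand : ClosedWalk n k → ℕ → Fin k
  hand w t = proj₁ (pos w t)

  height : ClosedWalk n k → ℕ → ℕ
  height w t = proj₂ (pos w t)

  hands : ClosedWalk n k → Fin n → Fin k
  hands w = hand w ∘ toℕ

  _≐_ : ClosedWalk n k → ClosedWalk n k → Set
  v ≐ w = ∀ (i : Fin n) → pos v (toℕ i) ≡ pos w (toℕ i)

  ≐-intro : ∀ {v w : ClosedWalk n k} → hands v ≗ hands w →
            (∀ i → height v (toℕ i) ≡ height w (toℕ i)) → v ≐ w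
  ≐-intro hands≗ heights≗ i = cong₂ _,_ (hands≗ i) (heights≗ i)

  shift : ClosedWalk n k → ℕ → ClosedWalk n k
  shift w r = record
    { pos          = λ t → pos w (t + r)
    ; pos-periodic = shift-periodic (pos-periodic w) r
    ; pos-step     = λ t → pos-step w (t + r)
    }

  walk : Cycle n k → ClosedWalk n k
  walk c = record { pos = vert c ; pos-periodic = periodic c ; pos-step = λ t → ⟶⇒↝ (step c t) }

  fall : ∀ (w : ClosedWalk n k) t {i} h j → pos w t ≡ (i , j + h) → pos w (t + j) ≡ (i , h)
  fall w t h zero    w≡ = trans (cong (pos w) (+-identityʳ t)) w≡
  fall w t h (suc j) w≡ =
    trans (cong (pos w) (+-suc t j)) (fall w (suc t) h j (subst (_↝ pos w (suc t)) w≡ (pos-step w t)))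

  module _ .{{_ : NonZero n}} where

    -- A ball at height h ≥ n would fall to h − n after one period, yet come back to h.
    height<n : ∀ (w : ClosedWalk n k) t → height w t < n
    height<n w t with n ≤? height w t
    ... | no  n≰h = ≰⇒> n≰h
    ... | yes n≤h = contradiction (sym (cong proj₂ loop)) (<⇒≢ h∸n<h)
      where
      h∸n<h : height w t ∸ n < height w t
      h∸n<h = subst (height w t ∸ n <_) (m+[n∸m]≡n n≤h) (m<n+m (height w t ∸ n) (>-nonZero⁻¹ n))
      loop : pos w t ≡ (hand w t , height w t ∸ n)
      loop = trans (sym (pos-periodic w t))
                   (fall w t (height w t ∸ n) n (cong (hand w t ,_) (sym (m+[n∸m]≡n n≤h))))

    hands-next : ∀ (w : ClosedWalk n k) i → height w (toℕ i) ≢ 0 → hands w (next i) ≡ hands w i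
    hands-next w i h≢0 =
      trans (cong proj₁ (sym (periodic-mod (pos-periodic w) (suc (toℕ i))))) (↝-hand (pos-step w (toℕ i)) h≢0)

    height≢0⇒repeats : ∀ (w : ClosedWalk n k) i → height w (toℕ i) ≢ 0 → Repeats (hands w)
    height≢0⇒repeats w i h≢0 =
      next i , i , next≢ (≤-<-trans (n≢0⇒n>0 h≢0) (height<n w (toℕ i))) i , hands-next w i h≢0

    ¬repeats⇒height≡0 : ∀ w → ¬ Repeats (hands w) → ∀ i → height w (toℕ i) ≡ 0
    ¬repeats⇒height≡0 w ¬r i with height w (toℕ i) ℕ.≟ 0
    ... | yes h≡0 = h≡0
    ... | no  h≢0 = contradiction (height≢0⇒repeats w i h≢0) ¬r

module _ {n k : ℕ} .{{_ : NonZero n}} where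

  IsCycleTable : (Fin n → State k) → Set
  IsCycleTable D = (∀ i → D i ↝ D (next i)) × (∀ i j → D i ≡ D j → i ≡ j)

  isCycleTable? : ∀ D → Dec (IsCycleTable D)
  isCycleTable? D = all? (λ i → D i ↝? D (next i))
             ×-dec all? (λ i → all? λ j → (D i ≟ₛ D j) →-dec (i Fin.≟ j))

  isCycleTable-resp : ∀ {D E} → D ≗ E → IsCycleTable D → IsCycleTable E
  isCycleTable-resp D≗E (steps , inj) =
      (λ i → subst₂ _↝_ (D≗E i) (D≗E (next i)) (steps i))
    , (λ i j Ei≡Ej → inj i j (trans (D≗E i) (trans Ei≡Ej (sym (D≗E j)))))

  fromTable : ∀ D → IsCycleTable D → Cycle n k
  fromTable D (steps , inj) = record
    { vert     = D ∘ (_mod n)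
    ; periodic = cong D ∘ mod-periodic
    ; step     = λ t → ↝⇒⟶ (subst (D (t mod n) ↝_) (cong D (sym (suc-mod t))) (steps (t mod n)))
    ; distinct = λ s t s<n t<n Ds≡Dt → begin
        s                ≡⟨ toℕ-mod-< s<n ⟨
        toℕ (s mod n)    ≡⟨ cong toℕ (inj _ _ Ds≡Dt) ⟩
        toℕ (t mod n)    ≡⟨ toℕ-mod-< t<n ⟩
        t                ∎
    }
    where open ≡-Reasoning

  table : Cycle n k → Fin n → State k
  table c = vert c ∘ toℕ

  table-isCycleTable : ∀ c → IsCycleTable (table c)
  table-isCycleTable c =
      (λ i → subst (table c i ↝_) (periodic-mod (periodic c) (suc (toℕ i))) (⟶⇒↝ (step c (toℕ i))))
    , (λ i j e → toℕ-injective (distinct c _ _ (toℕ<n i) (toℕ<n j) e))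

module PrimePatterns (n′ k : ℕ) where

  n : ℕ
  n = suc n′

  -- Shifting d by s * n′ + s = s * n does nothing.
  shifts⇒≈rot : ∀ {c d : Cycle n k} r s → (∀ t → vert c (t + r) ≡ vert d (t + s)) → c ≈rot d
  shifts⇒≈rot {c} {d} r s c≡d = s * n′ + r , λ t → begin
    vert d t                  ≡⟨ periodic-+* (periodic d) t s ⟨
    vert d (t + s * n)        ≡⟨ cong (λ m → vert d (t + m)) (*-suc s n′) ⟩
    vert d (t + (s + s * n′)) ≡⟨ cong (vert d) (x∙yz≈xz∙y t s (s * n′)) ⟩
    vert d (t + s * n′ + s)   ≡⟨ c≡d (t + s * n′) ⟨
    vert c (t + s * n′ + r)   ≡⟨ cong (vert c) (+-assoc t (s * n′) r) ⟩
    vert c (t + (s * n′ + r)) ∎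
    where open ≡-Reasoning

  ≈rot-refl : Reflexive (_≈rot_ {n} {k})
  ≈rot-refl {c} = 0 , λ t → cong (vert c) (sym (+-identityʳ t))

  ≈rot-sym : Symmetric (_≈rot_ {n} {k})
  ≈rot-sym {c} {d} (r , d≡c) =
    shifts⇒≈rot {d} {c} 0 r λ t → trans (cong (vert d) (+-identityʳ t)) (d≡c t)

  ≈rot-trans : Transitive (_≈rot_ {n} {k})
  ≈rot-trans {c} (r , d≡c) (s , e≡d) =
    s + r , λ t → trans (e≡d t) (trans (d≡c (t + s)) (cong (vert c) (+-assoc t s r)))

  _≈rot?_ : Decidable (_≈rot_ {n} {k})
  c ≈rot? d = map′
    (λ (r , d≐c) → toℕ r , periodic-agree (periodic d) (shift-periodic (periodic c) (toℕ r)) d≐c)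
    (λ (r , d≡c) → r mod n , λ i → trans (d≡c (toℕ i)) (shift-mod (periodic c) (toℕ i) r))
    (any? λ r → all? λ i → vert d (toℕ i) ≟ₛ vert c (toℕ i + toℕ r))

  rotationDecSetoid : DecSetoid 0ℓ 0ℓ
  rotationDecSetoid = record
    { Carrier          = Cycle n k
    ; _≈_              = _≈rot_
    ; isDecEquivalence = record
      { isEquivalence = record
        { refl  = λ {c} → ≈rot-refl {c}
        ; sym   = λ {c} {d} → ≈rot-sym {c} {d}
        ; trans = λ {c} {d} {e} → ≈rot-trans {c} {d} {e}
        }
      ; _≟_           = _≈rot?_
      }
    }

  rotationSetoid : Setoid 0ℓ 0ℓ
  rotationSetoid = DecSetoid.setoid rotationDecSetoid

  tableCode : Cycle n k → Fin n → Fin (k * n)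
  tableCode c i = combine (hand (walk c) (toℕ i)) (fromℕ< (height<n (walk c) (toℕ i)))

  toState : Fin k × Fin n → State k
  toState (h , b) = h , toℕ b

  decodeTable : Fin ((k * n) ^ n) → Fin n → State k
  decodeTable z = toState ∘ remQuot n ∘ finToFun z

  decodeTable-tableCode : ∀ c → decodeTable (funToFin (tableCode c)) ≗ table c
  decodeTable-tableCode c i = begin
    toState (remQuot n (finToFun (funToFin (tableCode c)) i))
      ≡⟨ cong (toState ∘ remQuot n) (finToFun-funToFin (tableCode c) i) ⟩
    toState (remQuot n (tableCode c i))
      ≡⟨ cong toState (remQuot-combine (hand (walk c) (toℕ i)) _) ⟩
    hand (walk c) (toℕ i) , toℕ (fromℕ< _)
      ≡⟨ cong (hand (walk c) (toℕ i) ,_) (toℕ-fromℕ< _) ⟩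
    table c i
      ∎
    where open ≡-Reasoning

  cyclesFrom : ∀ D → Dec (IsCycleTable D) → List (Cycle n k)
  cyclesFrom D (yes p) = fromTable D p ∷ []
  cyclesFrom D (no _)  = []

  cyclesFrom-table : ∀ c {D} → D ≗ table c → (d : Dec (IsCycleTable D)) →
                     Any (c ≈rot_) (cyclesFrom D d)
  cyclesFrom-table c {D} D≗c (yes p) = here (0 , λ t → begin
    D (t mod n)              ≡⟨ D≗c (t mod n) ⟩
    vert c (toℕ (t mod n))   ≡⟨ periodic-mod (periodic c) t ⟨
    vert c t                 ≡⟨ cong (vert c) (+-identityʳ t) ⟨
    vert c (t + 0)           ∎)
    where open ≡-Reasoning
  cyclesFrom-table c D≗c (no ¬p) =
    contradiction (isCycleTable-resp (sym ∘ D≗c) (table-isCycleTable c)) ¬p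

  -- Heights are below n, so the tables with entries in Fin k × Fin n cover every cycle.
  candidates : List (Cycle n k)
  candidates = concatMap (λ z → cyclesFrom (decodeTable z) (isCycleTable? _)) (allFin _)

  candidates-enumerate : IsEnumeration rotationSetoid candidates
  candidates-enumerate c = concatMap⁺ _ (Any.map (λ { refl → covered }) (∈-allFin (funToFin (tableCode c))))
    where
    covered : Any (c ≈rot_) (cyclesFrom (decodeTable (funToFin (tableCode c))) (isCycleTable? _))
    covered = cyclesFrom-table c (decodeTable-tableCode c) (isCycleTable? _)

  classes : List (Cycle n k)
  classes = deduplicate _≈rot?_ candidates

  count : ℕ
  count = length classes

  class : Fin count → Cycle n k
  class = lookup classes

  class-surjective : ∀ c → ∃ λ x → class x ≈rot c
  class-surjective c =
    let x , x≈c = lookup-surjective rotationSetoid (deduplicate⁺ rotationDecSetoid candidates-enumerate) c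
    in  x , x≈c refl

  class-injective : ∀ x y → class x ≈rot class y → x ≡ y
  class-injective = Unique⇒lookup-injective rotationSetoid (deduplicate-! rotationDecSetoid candidates)

  primeCount : PrimeCount n k count
  primeCount = class , class-surjective , class-injective

  heights : ClosedWalk n k → Fin n → Fin n
  heights w i = fromℕ< (height<n w (toℕ i))

  heights-injective : ∀ {v w} → funToFin (heights v) ≡ funToFin (heights w) →
                      ∀ i → height v (toℕ i) ≡ height w (toℕ i)
  heights-injective {v} {w} e i = begin
    height v (toℕ i)    ≡⟨ toℕ-fromℕ< (height<n v (toℕ i)) ⟨
    toℕ (heights v i)   ≡⟨ cong toℕ (funToFin-injective {f = heights v} {heights w} e i) ⟩
    toℕ (heights w i)   ≡⟨ toℕ-fromℕ< (height<n w (toℕ i)) ⟩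
    height w (toℕ i)    ∎
    where open ≡-Reasoning

  walkCode : ∀ w → Dec (Repeats (hands w)) → Fin (k ^ n + n ^ n * (n * (n * k ^ n′)))
  walkCode w (no _)  = funToFin (hands w) ↑ˡ _
  walkCode w (yes r) = k ^ n ↑ʳ combine (funToFin (heights w)) (repeatCode (hands w) r)

  walkCode-injective : ∀ v w dv dw → walkCode v dv ≡ walkCode w dw → v ≐ w
  walkCode-injective v w (no ¬rv) (no ¬rw) e =
    ≐-intro {v = v} {w} (funToFin-injective (↑ˡ-injective _ _ _ e))
      (λ i → trans (¬repeats⇒height≡0 v ¬rv i) (sym (¬repeats⇒height≡0 w ¬rw i)))
  walkCode-injective v w (no _)  (yes _) e = contradiction e (↑ˡ≢↑ʳ _ _)
  walkCode-injective v w (yes _) (no _)  e = contradiction (sym e) (↑ˡ≢↑ʳ _ _)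
  walkCode-injective v w (yes rv) (yes rw) e =
    ≐-intro {v = v} {w} (repeatCode-injective rv rw (proj₂ codes≡))
                        (heights-injective {v} {w} (proj₁ codes≡))
    where
    codes≡ : funToFin (heights v) ≡ funToFin (heights w) × repeatCode (hands v) rv ≡ repeatCode (hands w) rw
    codes≡ = combine-injective (funToFin (heights v)) (repeatCode (hands v) rv)
                               (funToFin (heights w)) (repeatCode (hands w) rw) (↑ʳ-injective (k ^ n) _ _ e)

  rotation : Fin n × Fin count → ClosedWalk n k
  rotation (r , x) = shift (walk (class x)) (toℕ r)

  rotation-injective : ∀ {a b} → rotation a ≐ rotation b → a ≡ b
  rotation-injective {r , x} {s , y} a≐b
    with class-injective x y (shifts⇒≈rot {class x} {class y} (toℕ r) (toℕ s) agree)
    where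
    agree : ∀ t → vert (class x) (t + toℕ r) ≡ vert (class y) (t + toℕ s)
    agree = periodic-agree (pos-periodic (rotation (r , x))) (pos-periodic (rotation (s , y))) a≐b
  ... | refl = cong (_, x) (toℕ-injective (distinct (class x) _ _ (toℕ<n r) (toℕ<n s) (a≐b Fin.zero)))

  upper-bound : n * count ≤ k ^ n + n ^ n * (n * (n * k ^ n′))
  upper-bound = injective⇒≤ {f = code} code-injective
    where
    walkOf : Fin (n * count) → ClosedWalk n k
    walkOf z = rotation (remQuot count z)
    decide : ∀ z → Dec (Repeats (hands (walkOf z)))
    decide z = repeats? Fin._≟_ (hands (walkOf z))
    code : Fin (n * count) → Fin (k ^ n + n ^ n * (n * (n * k ^ n′)))
    code z = walkCode (walkOf z) (decide z)
    code-injective : ∀ {y z} → code y ≡ code z → y ≡ z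
    code-injective {y} {z} e = remQuot-injective {n} {count}
      (rotation-injective (walkCode-injective (walkOf y) (walkOf z) (decide y) (decide z) e))

  fromDistinctHands : (v : Fin n → Fin k) → ¬ Repeats v → Cycle n k
  fromDistinctHands v ¬r =
    fromTable (λ i → v i , 0) ((λ _ → tt) , λ i j e → ¬repeats⇒injective ¬r i j (cong proj₁ e))

  classCode : ∀ c → ∃ (λ x → class x ≈rot c) → Fin (n * count)
  classCode c (x , r , _) = combine (r mod n) x

  classCode-injective : ∀ c d sc sd → classCode c sc ≡ classCode d sd → walk c ≐ walk d
  classCode-injective c d (x , r , c≡) (y , s , d≡) e with combine-injective (r mod n) x (s mod n) y e
  ... | r≡s , refl = λ i → begin
    vert c (toℕ i)                          ≡⟨ c≡ (toℕ i) ⟩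
    vert (class x) (toℕ i + r)              ≡⟨ shift-mod (periodic (class x)) (toℕ i) r ⟩
    vert (class x) (toℕ i + toℕ (r mod n))  ≡⟨ cong (λ q → vert (class x) (toℕ i + toℕ q)) r≡s ⟩
    vert (class x) (toℕ i + toℕ (s mod n))  ≡⟨ shift-mod (periodic (class x)) (toℕ i) s ⟨
    vert (class x) (toℕ i + s)              ≡⟨ d≡ (toℕ i) ⟨
    vert d (toℕ i)                          ∎
    where open ≡-Reasoning

  handsCode : ∀ v → Dec (Repeats v) → Fin (n * count + n * (n * k ^ n′))
  handsCode v (no ¬r) = classCode c (class-surjective c) ↑ˡ n * (n * k ^ n′)
    where c = fromDistinctHands v ¬r
  handsCode v (yes r) = n * count ↑ʳ repeatCode v r

  handsCode-injective : ∀ u v du dv → handsCode u du ≡ handsCode v dv → u ≗ v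
  handsCode-injective u v (no ¬ru) (no ¬rv) e i = subst (λ j → u j ≡ v j) (mod-toℕ i) (cong proj₁ (cu≐cv i))
    where
    cu cv : Cycle n k
    cu = fromDistinctHands u ¬ru
    cv = fromDistinctHands v ¬rv
    cu≐cv : walk cu ≐ walk cv
    cu≐cv = classCode-injective cu cv (class-surjective cu) (class-surjective cv) (↑ˡ-injective _ _ _ e)
  handsCode-injective u v (no _)  (yes _) e = contradiction e (↑ˡ≢↑ʳ _ _)
  handsCode-injective u v (yes _) (no _)  e = contradiction (sym e) (↑ˡ≢↑ʳ _ _)
  handsCode-injective u v (yes ru) (yes rv) e = repeatCode-injective ru rv (↑ʳ-injective (n * count) _ _ e)

  lower-bound : k ^ n ≤ n * count + n * (n * k ^ n′)
  lower-bound = injective⇒≤ {f = code} code-injective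
    where
    decide : ∀ z → Dec (Repeats (finToFun z))
    decide z = repeats? Fin._≟_ (finToFun z)
    code : Fin (k ^ n) → Fin (n * count + n * (n * k ^ n′))
    code z = handsCode (finToFun z) (decide z)
    code-injective : ∀ {y z} → code y ≡ code z → y ≡ z
    code-injective {y} {z} e =
      finToFun-injective {k} {n} (handsCode-injective (finToFun y) (finToFun z) (decide y) (decide z) e)

  error-bound : ∣ n * count - k ^ n ∣ ≤ n ^ n * (n * n) * k ^ n′
  error-bound = ∣m-n∣≤o upper lower
    where
    open ≤-Reasoning
    regroup : n ^ n * (n * (n * k ^ n′)) ≡ n ^ n * (n * n) * k ^ n′
    regroup = trans (cong (n ^ n *_) (sym (*-assoc n n (k ^ n′)))) (sym (*-assoc (n ^ n) (n * n) (k ^ n′)))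
    upper : n * count ≤ k ^ n + n ^ n * (n * n) * k ^ n′
    upper = ≤-trans upper-bound (≤-reflexive (cong (k ^ n +_) regroup))
    lower : k ^ n ≤ n * count + n ^ n * (n * n) * k ^ n′
    lower = ≤-trans lower-bound (+-monoʳ-≤ (n * count) (begin
      n * (n * k ^ n′)             ≤⟨ m≤n*m _ (n ^ n) {{m^n≢0 n n}} ⟩
      n ^ n * (n * (n * k ^ n′))   ≡⟨ regroup ⟩
      n ^ n * (n * n) * k ^ n′     ∎))

proposition5p2 : ∀ (n : ℕ) → 1 ≤ n →
    Σ (ℕ → ℕ) λ P →
      (∀ k → PrimeCount n k (P k)) ×
      (∀ e → ∃ λ K → ∀ k → K ≤ k → suc e * ∣ n * P k - k ^ n ∣ ≤ k ^ n)
proposition5p2 (suc n′) _ =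
    PrimePatterns.count n′
  , PrimePatterns.primeCount n′
  , λ e → suc e * (n ^ n * (n * n)) , λ k → relative-error e n′ (PrimePatterns.error-bound n′ k)
  where
  n : ℕ
  n = suc n′
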